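{- Let $\Lambda$ be a distributive cross section lattice of a $J$-irreducible monoid of type $A_n$, with $\Delta$, $J_0$ as in the context. If $|\Delta\setminus J_0|>1$, then every interval of rank three in $\Lambda^*=\Lambda\setminus\{0\}$ is isomorphic to one of: (1) the Boolean lattice $2^{\{a,b,c\}}$; (2) the poset on $\{a,b,c,d,e,f\}$ generated by the relations $a<b$, $a<c$, $b<d$, $c<d$, $c<e$, $e<f$, $d<f$; (3) the chain $a<b<c<d$.
   Context: Let $K$ be an algebraically closed field, $G_0$ a simple algebraic group of type $A_n$, $\rho:G_0\to GL(V)$ an irreducible rational representation, $G=K^*\cdot\rho(G_0)$, $M=\overline{G}\subseteq\mathrm{End}(V)$ its Zariski closure. A cross section lattice is a finite set $\Lambda$ of idempotents of $M$ meeting every $G\times G$-orbit in exactly one element, ordered by $e\le f\iff e=ef=fe$; it is a graded lattice with least element $0$ and unique minimal nonzero element $e_0$. Let $T=C_G(\Lambda)$, $B=\{g\in G:ge=ege\ \forall e\in\Lambda\}$, $\Delta$ the simple roots of $T$ relative to $B$, $\sigma_\alpha$ the simple reflections, $\phi(e)=\{\alpha\in\Delta:\sigma_\alpha e=e\sigma_\alpha\ne e\}$, $J_0=\{\alpha\in\Delta:\sigma_\alpha e_0=e_0\sigma_\alpha\}$. By Putcha–Renner, $\phi|_{\Lambda^*}$ is an order isomorphism onto the family of $I\subseteq\Delta$ (ordered by inclusion) no connected component of which (in the Dynkin diagram) lies entirely in $J_0$. -}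

module Defs where

open import Data.Nat using (ℕ; zero; suc; _<_; _≤_)
open import Data.Fin using (Fin; toℕ)
import Data.Fin as F
open import Data.Fin.Subset using (Subset; _∈_; _∉_; _⊆_; ∣_∣; ∁)
open import Data.Product using (Σ; ∃; _×_; _,_; proj₁; proj₂)
open import Data.Sum using (_⊎_)
open import Data.Maybe using (Maybe; just; nothing)
open import Data.Unit using (⊤)
open import Data.Empty using (⊥)
open import Relation.Binary.PropositionalEquality using (_≡_)

-- Dynkin diagram of type A_n: simple roots Δ = Fin n, α_i — α_{i+1}.

Adj : ∀ {n} → Fin n → Fin n → Set
Adj i j = (suc (toℕ i) ≡ toℕ j) ⊎ (suc (toℕ j) ≡ toℕ i)

data Conn {n : ℕ} (I : Subset n) : Fin n → Fin n → Set where
  here : ∀ {i} → i ∈ I → Conn I i i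
  step : ∀ {i j k} → Conn I i j → Adj j k → k ∈ I → Conn I i k

Admissible : ∀ {n} → Subset n → Subset n → Set
Admissible J₀ I = ∀ i → i ∈ I → ∃ λ j → Conn I i j × j ∉ J₀

-- Λ* (via the Putcha–Renner isomorphism φ) and Λ = Λ* ∪ {0}.

ΛStar : ∀ {n} → Subset n → Set
ΛStar J₀ = Σ (Subset _) (Admissible J₀)

_≤*_ : ∀ {n} {J₀ : Subset n} → ΛStar J₀ → ΛStar J₀ → Set
a ≤* b = proj₁ a ⊆ proj₁ b

Λ : ∀ {n} → Subset n → Set
Λ J₀ = Maybe (ΛStar J₀)        -- nothing = the zero idempotent 0

_≤Λ_ : ∀ {n} {J₀ : Subset n} → Λ J₀ → Λ J₀ → Set
nothing ≤Λ _ = ⊤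
just a ≤Λ nothing = ⊥
just a ≤Λ just b = a ≤* b

_≈Λ_ : ∀ {n} {J₀ : Subset n} → Λ J₀ → Λ J₀ → Set
x ≈Λ y = (x ≤Λ y) × (y ≤Λ x)

IsMeet : ∀ {n} {J₀ : Subset n} → Λ J₀ → Λ J₀ → Λ J₀ → Set
IsMeet {J₀ = J₀} x y m =
  (m ≤Λ x) × (m ≤Λ y) × (∀ (z : Λ J₀) → z ≤Λ x → z ≤Λ y → z ≤Λ m)

IsJoin : ∀ {n} {J₀ : Subset n} → Λ J₀ → Λ J₀ → Λ J₀ → Set
IsJoin {J₀ = J₀} x y j =
  (x ≤Λ j) × (y ≤Λ j) × (∀ (z : Λ J₀) → x ≤Λ z → y ≤Λ z → j ≤Λ z)

Distributive : ∀ {n} → Subset n → Set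
Distributive J₀ = ∀ (x y z yz l xy xz r : Λ J₀) →
  IsJoin y z yz → IsMeet x yz l → IsMeet x y xy → IsMeet x z xz →
  IsJoin xy xz r → l ≈Λ r

_<*_ : ∀ {n} {J₀ : Subset n} → ΛStar J₀ → ΛStar J₀ → Set
a <* b = (a ≤* b) × ((b ≤* a) → ⊥)

Covers : ∀ {n} {J₀ : Subset n} → ΛStar J₀ → ΛStar J₀ → Set
Covers {J₀ = J₀} a b = (a <* b) × (∀ (c : ΛStar J₀) → a <* c → c <* b → ⊥)

data SatChain {n : ℕ} {J₀ : Subset n} : ΛStar J₀ → ΛStar J₀ → ℕ → Set where
  [] : ∀ {a b} → a ≤* b → b ≤* a → SatChain a b 0
  _∷_ : ∀ {a b c k} → Covers a b → SatChain b c k → SatChain a c (suc k)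

RankInterval : ∀ {n} {J₀ : Subset n} → ΛStar J₀ → ΛStar J₀ → ℕ → Set
RankInterval x y k =
  (x ≤* y) × SatChain x y k × (∀ m → SatChain x y m → m ≡ k)

Interval : ∀ {n} {J₀ : Subset n} → ΛStar J₀ → ΛStar J₀ → Set
Interval {J₀ = J₀} x y = Σ (ΛStar J₀) λ z → (x ≤* z) × (z ≤* y)

record FinPoset : Set₁ where
  field
    Carrier : Set
    _⊑_ : Carrier → Carrier → Set

record IntervalIso {n} {J₀ : Subset n} (x y : ΛStar J₀) (P : FinPoset) : Set where
  open FinPoset P
  field
    to   : Interval x y → Carrier
    from : Carrier → Interval x y
    from∘to : ∀ z → proj₁ (proj₁ (from (to z))) ≡ proj₁ (proj₁ z)
    to∘from : ∀ p → to (from p) ≡ p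
    mono : ∀ z w → proj₁ z ≤* proj₁ w → to z ⊑ to w
    reflect : ∀ z w → to z ⊑ to w → proj₁ z ≤* proj₁ w

Boolean3 : FinPoset
Boolean3 = record { Carrier = Subset 3 ; _⊑_ = _⊆_ }

-- (2) a<b, a<c, b<d, c<d, c<e, e<f, d<f  (a..f = 0..5), reflexive–transitive closure
data Le6 : Fin 6 → Fin 6 → Set where
  refl6 : ∀ {i} → Le6 i i
  a<b : Le6 F.zero (F.suc F.zero)
  a<c : Le6 F.zero (F.suc (F.suc F.zero))
  b<d : Le6 (F.suc F.zero) (F.suc (F.suc (F.suc F.zero)))
  c<d : Le6 (F.suc (F.suc F.zero)) (F.suc (F.suc (F.suc F.zero)))
  c<e : Le6 (F.suc (F.suc F.zero)) (F.suc (F.suc (F.suc (F.suc F.zero))))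
  e<f : Le6 (F.suc (F.suc (F.suc (F.suc F.zero)))) (F.suc (F.suc (F.suc (F.suc (F.suc F.zero)))))
  d<f : Le6 (F.suc (F.suc (F.suc F.zero))) (F.suc (F.suc (F.suc (F.suc (F.suc F.zero)))))
  trans6 : ∀ {i j k} → Le6 i j → Le6 j k → Le6 i k

Poset6 : FinPoset
Poset6 = record { Carrier = Fin 6 ; _⊑_ = Le6 }

Chain4 : FinPoset
Chain4 = record { Carrier = Fin 4 ; _⊑_ = F._≤_ }

-- Distributivity forces the roots outside J₀ to form a segment of the diagram.  Fix one of them, u:
-- a set is then admissible iff it is closed under moving each J₀-root one place towards u, and this
-- step map is well founded, and injective once there are two roots outside J₀.  Hence a cover in Λ*
-- adds a single root whose step lands in the smaller set, and a rank-three interval [X, X ∪ {d₀,d₁,d₂}]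
-- is the lattice of down-sets of the step relation on d₀, d₁, d₂.  That relation is a disjoint union
-- of chains with three points in total (an antichain, a two-chain and a point, or a three-chain), and
-- their down-set lattices are the three posets of the theorem.

module Submission where

open import Defs
open import Data.Nat using (ℕ; _<_)
open import Data.Fin.Subset using (Subset; ∣_∣; ∁)
open import Data.Sum using (_⊎_)

open import Data.Empty using (⊥; ⊥-elim)
open import Data.Fin using (Fin; zero; suc; toℕ; fromℕ<; inject₁; _≟_)
open import Data.Fin.Patterns using (0F; 1F; 2F; 3F; 4F; 5F)
open import Data.Fin.Permutation using (Permutation; _⟨$⟩ʳ_; _⟨$⟩ˡ_; inverseˡ; inverseʳ; transpose; _∘ₚ_)
open import Data.Fin.Properties using (any?; toℕ-injective; toℕ-fromℕ<; toℕ-inject₁; toℕ<n)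
import Data.Fin.Properties as Finₚ
open import Data.Fin.Subset using (_∈_; _∉_; _⊆_; _∪_; ⁅_⁆; inside; outside) renaming (⊥ to ∅)
open import Data.Fin.Subset.Properties
  using (_∈?_; _⊆?_; ⊆-antisym; ∣p∣≤n; p⊆q⇒∣p∣≤∣q∣; x∈p∪q⁻; p⊆p∪q; q⊆p∪q; x∈⁅x⁆; x∈⁅y⁆⇒x≡y;
         x∈∁p⇒x∉p; x∉p⇒x∈∁p; ⊥⊆; ∉⊥)
open import Data.Maybe using (Maybe; just; nothing)
open import Data.Maybe.Relation.Unary.All using (All; just; nothing)
open import Data.Nat using (zero; suc; _+_; _∸_; _≤_; _≤?_; _<?_; s≤s; z≤n; ∣_-_∣)
open import Data.Nat.Induction using (<-wellFounded)
open import Data.Nat.Properties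
  using (≤-refl; ≤-trans; ≤-antisym; ≤-total; <⇒≤; <-trans; <-asym; <-irrefl; <-cmp; ≤-<-trans; <-≤-trans;
         ≮⇒≥; ≰⇒>; ≤-reflexive; n≤1+n; 1+n≰n; m<1+n⇒m≤n; m≤n+m; m∸n+n≡m; +-suc; suc-injective;
         m≤n⇒∣m-n∣≡n∸m; m≤n⇒∣n-m∣≡n∸m; ∸-monoʳ-<; ∸-monoˡ-<)
open import Data.Product using (Σ; ∃; _×_; _,_; proj₁; proj₂)
import Data.Product as Prod
open import Data.Sum using (inj₁; inj₂; swap)
import Data.Sum as Sum
open import Data.Unit using (tt)
open import Data.Vec using (tabulate; []; _∷_; here; there)
open import Data.Vec.Properties using (lookup∘tabulate; []=⇒lookup; lookup⇒[]=)
open import Function using (flip; _∘_; case_of_)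
open import Induction.WellFounded using (WellFounded; module Subrelation)
import Induction.WellFounded as WF
import Relation.Binary.Construct.On as On
open import Relation.Binary.Definitions using (tri<; tri≈; tri>)
open import Relation.Binary.PropositionalEquality
  using (_≡_; _≢_; refl; sym; trans; cong; subst; subst₂; module ≡-Reasoning)
open import Relation.Nullary using (Dec; yes; no; does; ¬_; ¬?; _×-dec_; _⊎-dec_)
open import Relation.Nullary.Decidable using (dec-true; True; toWitness; fromWitness)

private
  variable
    n : ℕ

subset : {P : Fin n → Set} → (∀ i → Dec (P i)) → Subset n
subset P? = tabulate (λ i → does (P? i))

module _ {P : Fin n → Set} (P? : ∀ i → Dec (P i)) where

  ∈-subset⁺ : ∀ {i} → P i → i ∈ subset P?
  ∈-subset⁺ {i} p = lookup⇒[]= i _ (trans (lookup∘tabulate _ i) (dec-true (P? i) p))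

  ∈-subset⁻ : ∀ {i} → i ∈ subset P? → P i
  ∈-subset⁻ {i} i∈ with P? i | trans (sym (lookup∘tabulate (λ i → does (P? i)) i)) ([]=⇒lookup i∈)
  ... | yes p | _ = p
  ... | no _ | ()

⊈⇒∃∉ : {A B : Subset n} → ¬ (B ⊆ A) → ∃ λ e → e ∈ B × e ∉ A
⊈⇒∃∉ {A = A} {B} B⊈A with any? (λ e → (e ∈? B) ×-dec ¬? (e ∈? A))
... | yes witness = witness
... | no none = ⊥-elim (B⊈A B⊆A)
  where
  B⊆A : B ⊆ A
  B⊆A {e} e∈B with e ∈? A
  ... | yes e∈A = e∈A
  ... | no e∉A = ⊥-elim (none (e , e∈B , e∉A))

nonempty : {p : Subset n} → 0 < ∣ p ∣ → ∃ λ u → u ∈ p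
nonempty {p = inside ∷ p} _ = zero , here
nonempty {p = outside ∷ p} 0<∣p∣ = Prod.map suc there (nonempty 0<∣p∣)

two-members : {p : Subset n} → 1 < ∣ p ∣ → ∃ λ u → ∃ λ v → u ≢ v × u ∈ p × v ∈ p
two-members {p = inside ∷ p} (s≤s 0<∣p∣) =
  let (v , v∈) = nonempty 0<∣p∣ in zero , suc v , (λ ()) , here , there v∈
two-members {p = outside ∷ p} 1<∣p∣ =
  let (u , v , u≢v , u∈ , v∈) = two-members 1<∣p∣
  in suc u , suc v , u≢v ∘ Finₚ.suc-injective , there u∈ , there v∈

next-above : {i k : Fin n} → toℕ i < toℕ k → ∃ λ (j : Fin n) → toℕ j ≡ suc (toℕ i)
next-above {k = k} i<k = fromℕ< (≤-<-trans i<k (toℕ<n k)) , toℕ-fromℕ< _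

next-below : {i k : Fin n} → toℕ k < toℕ i → ∃ λ (j : Fin n) → suc (toℕ j) ≡ toℕ i
next-below {i = suc i} _ = inject₁ i , cong suc (toℕ-inject₁ i)

module _ {I : Subset n} where

  Conn-end : {i k : Fin n} → Conn I i k → k ∈ I
  Conn-end (here i∈) = i∈
  Conn-end (step _ _ k∈) = k∈

  Conn-prepend : {i j k : Fin n} → Adj i j → i ∈ I → Conn I j k → Conn I i k
  Conn-prepend adj i∈ (here j∈) = step (here i∈) adj j∈
  Conn-prepend adj i∈ (step c adj′ k∈) = step (Conn-prepend adj i∈ c) adj′ k∈

  Conn-reverse : {i k : Fin n} → Conn I i k → Conn I k i
  Conn-reverse (here i∈) = here i∈
  Conn-reverse (step c adj k∈) = Conn-prepend (swap adj) k∈ (Conn-reverse c)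

  Adj-above : {j k f : Fin n} → Adj j k → toℕ j < toℕ f → toℕ f ≤ toℕ k → f ≡ k
  Adj-above (inj₁ 1+j≡k) j<f f≤k = toℕ-injective (≤-antisym f≤k (subst (_≤ _) 1+j≡k j<f))
  Adj-above (inj₂ 1+k≡j) j<f f≤k =
    ⊥-elim (<-irrefl refl (<-≤-trans (<-trans (subst (_ ≤_) 1+k≡j ≤-refl) j<f) f≤k))

  Conn-between : {i k f : Fin n} → Conn I i k → toℕ i ≤ toℕ f → toℕ f ≤ toℕ k → f ∈ I
  Conn-between (here i∈) i≤f f≤i = subst (_∈ I) (toℕ-injective (≤-antisym i≤f f≤i)) i∈
  Conn-between {f = f} (step {j = j} c adj k∈) i≤f f≤k with toℕ f ≤? toℕ j
  ... | yes f≤j = Conn-between c i≤f f≤j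
  ... | no f≰j = subst (_∈ I) (sym (Adj-above adj (≰⇒> f≰j) f≤k)) k∈

  Conn-upward : {i k : Fin n} → toℕ i ≤ toℕ k →
                (∀ {h : Fin n} → toℕ i ≤ toℕ h → toℕ h ≤ toℕ k → h ∈ I) → Conn I i k
  Conn-upward {i} {k} i≤k = walk (toℕ k ∸ toℕ i) (m∸n+n≡m i≤k)
    where
    walk : ∀ d {i} → d + toℕ i ≡ toℕ k → (∀ {h} → toℕ i ≤ toℕ h → toℕ h ≤ toℕ k → h ∈ I) → Conn I i k
    walk zero i≡k full = subst (Conn I _) (toℕ-injective i≡k) (here (full ≤-refl (≤-reflexive i≡k)))
    walk (suc d) {i} e full =
      Conn-prepend (inj₁ (sym j≡1+i)) (full ≤-refl i≤k′)
        (walk d (trans (cong (d +_) j≡1+i) (trans (+-suc d _) e))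
                (λ j≤h → full (≤-trans (n≤1+n _) (subst (_≤ _) j≡1+i j≤h))))
      where
      i≤k′ = subst (toℕ i ≤_) e (m≤n+m _ _)
      j≡1+i = proj₂ (next-above {k = k} (subst (toℕ i <_) e (s≤s (m≤n+m (toℕ i) d))))

between? : (a b : ℕ) (f : Fin n) → Dec (a ≤ toℕ f × toℕ f ≤ b)
between? a b f = (a ≤? toℕ f) ×-dec (toℕ f ≤? b)

opaque
  segment : ℕ → ℕ → Subset n
  segment a b = subset (between? a b)

  ∈-segment⁺ : {a b : ℕ} {f : Fin n} → a ≤ toℕ f → toℕ f ≤ b → f ∈ segment a b
  ∈-segment⁺ {a = a} {b} a≤f f≤b = ∈-subset⁺ (between? a b) (a≤f , f≤b)

  ∈-segment⁻ : {a b : ℕ} {f : Fin n} → f ∈ segment a b → a ≤ toℕ f × toℕ f ≤ b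
  ∈-segment⁻ {a = a} {b} = ∈-subset⁻ (between? a b)

module _ {a b : ℕ} where

  segment-upward : {f g : Fin n} → f ∈ segment a b → g ∈ segment a b →
                   toℕ f ≤ toℕ g → Conn (segment a b) f g
  segment-upward f∈ g∈ f≤g = Conn-upward f≤g λ f≤h h≤g →
    ∈-segment⁺ (≤-trans (proj₁ (∈-segment⁻ f∈)) f≤h) (≤-trans h≤g (proj₂ (∈-segment⁻ g∈)))

  segment-connected : {f g : Fin n} → f ∈ segment a b → g ∈ segment a b → Conn (segment a b) f g
  segment-connected {f = f} {g} f∈ g∈ with ≤-total (toℕ f) (toℕ g)
  ... | inj₁ f≤g = segment-upward f∈ g∈ f≤g
  ... | inj₂ g≤f = Conn-reverse (segment-upward g∈ f∈ g≤f)

module _ {J₀ : Subset n} where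

  segment-admissible : {a b : ℕ} {m : Fin n} → m ∈ segment a b → m ∉ J₀ → Admissible J₀ (segment a b)
  segment-admissible {m = m} m∈ m∉ f f∈ = m , segment-connected f∈ m∈ , m∉

  admissible⊆J₀⇒empty : {W : Subset n} {f : Fin n} → Admissible J₀ W → W ⊆ J₀ → f ∉ W
  admissible⊆J₀⇒empty adm W⊆J₀ f∈ = let (g , c , g∉) = adm _ f∈ in g∉ (W⊆J₀ (Conn-end c))

  ≤Λ-refl : (x : Λ J₀) → x ≤Λ x
  ≤Λ-refl nothing = tt
  ≤Λ-refl (just _) = λ x∈ → x∈

  meet-of-≤ : {x y : Λ J₀} → x ≤Λ y → IsMeet x y x
  meet-of-≤ {x} x≤y = ≤Λ-refl x , x≤y , λ _ z≤x _ → z≤x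

  meet-of-≥ : {x y : Λ J₀} → y ≤Λ x → IsMeet x y y
  meet-of-≥ {y = y} y≤x = y≤x , ≤Λ-refl y , λ _ _ z≤y → z≤y

  join-of-≥ : {x y : Λ J₀} → y ≤Λ x → IsJoin x y x
  join-of-≥ {x} y≤x = ≤Λ-refl x , y≤x , λ _ x≤z _ → x≤z

  -- x = x ∧ (y ∨ z) = (x ∧ y) ∨ (x ∧ z) = y
  distributive-squeeze : Distributive J₀ → {x y z y∨z x∧z : Λ J₀} → IsJoin y z y∨z → IsMeet x z x∧z →
                         y ≤Λ x → x ≤Λ y∨z → x∧z ≤Λ y → x ≤Λ y
  distributive-squeeze distributive {x} {y} {z} {y∨z} {x∧z} join meet y≤x x≤y∨z x∧z≤y =
    proj₁ (distributive x y z y∨z x y x∧z y join (meet-of-≤ {x = x} {y∨z} x≤y∨z)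
                        (meet-of-≥ {x = x} {y} y≤x) meet (join-of-≥ {x = y} {x∧z} x∧z≤y))

  e₀ : Λ J₀
  e₀ = just (∅ , λ _ f∈ → ⊥-elim (∉⊥ f∈))

  meet-within-J₀ : {x z : ΛStar J₀} → (∀ {f} → f ∈ proj₁ x → f ∈ proj₁ z → f ∈ J₀) →
                   IsMeet (just x) (just z) e₀
  meet-within-J₀ {x} {z} x∩z⊆J₀ = ⊥⊆ , ⊥⊆ , greatest
    where
    greatest : ∀ w → w ≤Λ just x → w ≤Λ just z → w ≤Λ e₀
    greatest nothing _ _ = tt
    greatest (just (W , admW)) W≤x W≤z f∈ =
      ⊥-elim (admissible⊆J₀⇒empty admW (λ g∈ → x∩z⊆J₀ (W≤x g∈) (W≤z g∈)) f∈)

Convex : Subset n → Set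
Convex S = ∀ {i j k} → toℕ i < toℕ j → toℕ j < toℕ k → i ∈ S → k ∈ S → j ∈ S

-- A J₀-root j between roots i < k outside J₀ contradicts distributivity for x = [i,j],
-- y = [i,j-1] and z = [j,k], since no admissible set other than ∅ lies inside x ∩ z = {j}.
distributive⇒convex : {J₀ : Subset n} → Distributive J₀ → Convex (∁ J₀)
distributive⇒convex {n} {J₀} distributive {i} {j} {k} i<j j<k i∈ k∈ = x∉p⇒x∈∁p j∉J₀
  where
  j′ = proj₁ (next-below i<j)
  1+j′≡j = proj₂ (next-below i<j)

  seg : (a b : Fin n) {m : Fin n} → m ∈ segment (toℕ a) (toℕ b) → m ∉ J₀ → ΛStar J₀
  seg a b m∈ m∉ = segment (toℕ a) (toℕ b) , segment-admissible m∈ m∉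

  x y z y∨z : ΛStar J₀
  x = seg i j (∈-segment⁺ ≤-refl (<⇒≤ i<j)) (x∈∁p⇒x∉p i∈)
  y = seg i j′ (∈-segment⁺ ≤-refl (m<1+n⇒m≤n (subst (toℕ i <_) (sym 1+j′≡j) i<j))) (x∈∁p⇒x∉p i∈)
  z = seg j k (∈-segment⁺ (<⇒≤ j<k) ≤-refl) (x∈∁p⇒x∉p k∈)
  y∨z = seg i k (∈-segment⁺ ≤-refl (<⇒≤ (<-trans i<j j<k))) (x∈∁p⇒x∉p i∈)

  x≤y∨z : x ≤* y∨z
  x≤y∨z f∈ = let (i≤f , f≤j) = ∈-segment⁻ f∈ in ∈-segment⁺ i≤f (≤-trans f≤j (<⇒≤ j<k))

  y≤x : y ≤* x
  y≤x f∈ = let (i≤f , f≤j′) = ∈-segment⁻ f∈ in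
    ∈-segment⁺ i≤f (≤-trans f≤j′ (subst (toℕ j′ ≤_) 1+j′≡j (n≤1+n _)))

  z≤y∨z : z ≤* y∨z
  z≤y∨z f∈ = let (j≤f , f≤k) = ∈-segment⁻ f∈ in ∈-segment⁺ (≤-trans (<⇒≤ i<j) j≤f) f≤k

  join : IsJoin (just y) (just z) (just y∨z)
  join = x≤y∨z ∘ y≤x , z≤y∨z , least
    where
    least : ∀ w → just y ≤Λ w → just z ≤Λ w → just y∨z ≤Λ w
    least (just W) y≤W z≤W {f} f∈ with toℕ f <? toℕ j
    ... | yes f<j =
      y≤W (∈-segment⁺ (proj₁ (∈-segment⁻ f∈)) (m<1+n⇒m≤n (subst (toℕ f <_) (sym 1+j′≡j) f<j)))
    ... | no f≮j = z≤W (∈-segment⁺ (≮⇒≥ f≮j) (proj₂ (∈-segment⁻ f∈)))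

  j∉J₀ : j ∉ J₀
  j∉J₀ j∈J₀ = 1+n≰n (subst (_≤ toℕ j′) (sym 1+j′≡j) (proj₂ (∈-segment⁻ (x≤y j∈x))))
    where
    x∩z⊆J₀ : ∀ {f} → f ∈ proj₁ x → f ∈ proj₁ z → f ∈ J₀
    x∩z⊆J₀ f∈x f∈z =
      subst (_∈ J₀) (toℕ-injective (≤-antisym (proj₁ (∈-segment⁻ f∈z)) (proj₂ (∈-segment⁻ f∈x)))) j∈J₀
    x≤y : x ≤* y
    x≤y = distributive-squeeze distributive join (meet-within-J₀ {x = x} {z} x∩z⊆J₀) y≤x x≤y∨z ⊥⊆
    j∈x = ∈-segment⁺ (<⇒≤ i<j) ≤-refl

record Extension (A B : Subset n) (k : ℕ) : Set where
  field
    root           : Fin k → Fin n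
    root-injective : ∀ {i j} → root i ≡ root j → i ≡ j
    A⊆B            : A ⊆ B
    root∉A         : ∀ i → root i ∉ A
    root∈B         : ∀ i → root i ∈ B
    B⊆A∪roots      : ∀ {e} → e ∈ B → e ∈ A ⊎ ∃ λ i → e ≡ root i

module _ {A B : Subset n} {k : ℕ} (E : Extension A B k) where
  open Extension E

  reindex : Permutation k k → Extension A B k
  reindex π = record
    { root           = root ∘ (π ⟨$⟩ʳ_)
    ; root-injective = π-injective ∘ root-injective
    ; A⊆B            = A⊆B
    ; root∉A         = root∉A ∘ (π ⟨$⟩ʳ_)
    ; root∈B         = root∈B ∘ (π ⟨$⟩ʳ_)
    ; B⊆A∪roots      = Sum.map₂ (λ (i , e≡r) → π ⟨$⟩ˡ i , trans e≡r (cong root (sym (inverseʳ π)))) ∘ B⊆A∪roots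
    }
    where
    open ≡-Reasoning
    π-injective : ∀ {i j} → π ⟨$⟩ʳ i ≡ π ⟨$⟩ʳ j → i ≡ j
    π-injective {i} {j} eq = begin
      i                 ≡⟨ sym (inverseˡ π) ⟩
      π ⟨$⟩ˡ (π ⟨$⟩ʳ i)  ≡⟨ cong (π ⟨$⟩ˡ_) eq ⟩
      π ⟨$⟩ˡ (π ⟨$⟩ʳ j)  ≡⟨ inverseˡ π ⟩
      j                 ∎

  extended-by? : (S : Subset k) (e : Fin n) → Dec (e ∈ A ⊎ ∃ λ i → i ∈ S × e ≡ root i)
  extended-by? S e = (e ∈? A) ⊎-dec any? (λ i → (i ∈? S) ×-dec (e ≟ root i))

  opaque
    preimage : Subset n → Subset k
    preimage Z = subset (λ i → root i ∈? Z)

    ∈-preimage⁺ : ∀ {Z i} → root i ∈ Z → i ∈ preimage Z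
    ∈-preimage⁺ {Z} = ∈-subset⁺ (λ i → root i ∈? Z)

    ∈-preimage⁻ : ∀ {Z i} → i ∈ preimage Z → root i ∈ Z
    ∈-preimage⁻ {Z} = ∈-subset⁻ (λ i → root i ∈? Z)

    extend : Subset k → Subset n
    extend S = subset (extended-by? S)

    A⊆extend : ∀ {S} → A ⊆ extend S
    A⊆extend {S} e∈A = ∈-subset⁺ (extended-by? S) (inj₁ e∈A)

    root∈extend : ∀ {S i} → i ∈ S → root i ∈ extend S
    root∈extend {S} {i} i∈S = ∈-subset⁺ (extended-by? S) (inj₂ (i , i∈S , refl))

    ∈-extend⁻ : ∀ {S e} → e ∈ extend S → e ∈ A ⊎ ∃ λ i → i ∈ S × e ≡ root i
    ∈-extend⁻ {S} = ∈-subset⁻ (extended-by? S)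

  extend⊆B : ∀ {S} → extend S ⊆ B
  extend⊆B e∈ with ∈-extend⁻ e∈
  ... | inj₁ e∈A = A⊆B e∈A
  ... | inj₂ (i , _ , refl) = root∈B i

  extend-preimage : ∀ {Z} → A ⊆ Z → Z ⊆ B → extend (preimage Z) ≡ Z
  extend-preimage {Z} A⊆Z Z⊆B = ⊆-antisym extend⊆Z Z⊆extend
    where
    extend⊆Z : extend (preimage Z) ⊆ Z
    extend⊆Z e∈ with ∈-extend⁻ e∈
    ... | inj₁ e∈A = A⊆Z e∈A
    ... | inj₂ (i , i∈ , refl) = ∈-preimage⁻ i∈
    Z⊆extend : Z ⊆ extend (preimage Z)
    Z⊆extend e∈Z with B⊆A∪roots (Z⊆B e∈Z)
    ... | inj₁ e∈A = A⊆extend e∈A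
    ... | inj₂ (i , refl) = root∈extend (∈-preimage⁺ e∈Z)

  preimage-extend : ∀ {S} → preimage (extend S) ≡ S
  preimage-extend {S} = ⊆-antisym preimage⊆S (∈-preimage⁺ ∘ root∈extend)
    where
    preimage⊆S : preimage (extend S) ⊆ S
    preimage⊆S i∈ with ∈-extend⁻ (∈-preimage⁻ i∈)
    ... | inj₁ root∈A = ⊥-elim (root∉A _ root∈A)
    ... | inj₂ (j , j∈ , eq) = subst (_∈ S) (sym (root-injective eq)) j∈

  preimage-mono : ∀ {Z W} → Z ⊆ W → preimage Z ⊆ preimage W
  preimage-mono Z⊆W = ∈-preimage⁺ ∘ Z⊆W ∘ ∈-preimage⁻

  preimage-reflect : ∀ {Z W} → A ⊆ W → Z ⊆ B → preimage Z ⊆ preimage W → Z ⊆ W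
  preimage-reflect A⊆W Z⊆B pZ⊆pW e∈Z with B⊆A∪roots (Z⊆B e∈Z)
  ... | inj₁ e∈A = A⊆W e∈A
  ... | inj₂ (i , refl) = ∈-preimage⁻ (pZ⊆pW (∈-preimage⁺ e∈Z))

B⊆A∪root₀ : {A B : Subset n} (E : Extension A B 1) → ∀ {e} → e ∈ B → e ∈ A ⊎ e ≡ Extension.root E 0F
B⊆A∪root₀ E e∈B with Extension.B⊆A∪roots E e∈B
... | inj₁ e∈A = inj₁ e∈A
... | inj₂ (0F , e≡d) = inj₂ e≡d

module _ {A B C : Subset n} {k : ℕ} (E : Extension A B 1) (F : Extension B C k) where
  private
    module E = Extension E
    module F = Extension F

    ◅-root : Fin (suc k) → Fin n
    ◅-root 0F = E.root 0F
    ◅-root (suc i) = F.root i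

  _◅_ : Extension A C (suc k)
  _◅_ = record
    { root = ◅-root ; root-injective = injective ; A⊆B = F.A⊆B ∘ E.A⊆B
    ; root∉A = root∉A ; root∈B = root∈C ; B⊆A∪roots = C⊆A∪roots }
    where
    injective : ∀ {i j} → ◅-root i ≡ ◅-root j → i ≡ j
    injective {0F} {0F} _ = refl
    injective {0F} {suc j} d≡r = ⊥-elim (F.root∉A j (subst (_∈ B) d≡r (E.root∈B 0F)))
    injective {suc i} {0F} r≡d = ⊥-elim (F.root∉A i (subst (_∈ B) (sym r≡d) (E.root∈B 0F)))
    injective {suc i} {suc j} eq = cong suc (F.root-injective eq)
    root∉A : ∀ i → ◅-root i ∉ A
    root∉A 0F = E.root∉A 0F
    root∉A (suc i) = F.root∉A i ∘ E.A⊆B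
    root∈C : ∀ i → ◅-root i ∈ C
    root∈C 0F = F.A⊆B (E.root∈B 0F)
    root∈C (suc i) = F.root∈B i
    C⊆A∪roots : ∀ {e} → e ∈ C → e ∈ A ⊎ ∃ λ i → e ≡ ◅-root i
    C⊆A∪roots e∈C with F.B⊆A∪roots e∈C
    ... | inj₂ (i , e≡r) = inj₂ (suc i , e≡r)
    ... | inj₁ e∈B = Sum.map₂ (0F ,_) (B⊆A∪root₀ E e∈B)

empty-extension : {A B : Subset n} → A ⊆ B → B ⊆ A → Extension A B 0
empty-extension A⊆B B⊆A = record
  { root = λ () ; root-injective = λ { {()} } ; A⊆B = A⊆B
  ; root∉A = λ () ; root∈B = λ () ; B⊆A∪roots = inj₁ ∘ B⊆A }

TargetClosed : {k : ℕ} → (Fin k → Maybe (Fin k)) → Subset k → Set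
TargetClosed t S = ∀ {i} → i ∈ S → All (_∈ S) (t i)

-- P ≅ the V-subsets of Fin k under inclusion; decode is arbitrary outside V.
record SubsetModel (P : FinPoset) {k : ℕ} (V : Subset k → Set) : Set where
  open FinPoset P
  field
    code         : Carrier → Subset k
    decode       : Subset k → Carrier
    code-valid   : ∀ p → V (code p)
    decode-code  : ∀ p → decode (code p) ≡ p
    code-decode  : ∀ {S} → V S → code (decode S) ≡ S
    code-mono    : ∀ {p q} → p ⊑ q → code p ⊆ code q
    code-reflect : ∀ {p q} → code p ⊆ code q → p ⊑ q

module Steps {n : ℕ} (J₀ : Subset n) (convex : Convex (∁ J₀)) (u : Fin n) (u∉J₀ : u ∉ J₀) where

  between-outside : {i j k : Fin n} → toℕ i < toℕ j → toℕ j < toℕ k → i ∉ J₀ → k ∉ J₀ → j ∉ J₀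
  between-outside i<j j<k i∉ k∉ = x∈∁p⇒x∉p (convex i<j j<k (x∉p⇒x∈∁p i∉) (x∉p⇒x∈∁p k∉))

  Step : Fin n → Fin n → Set
  Step i j = i ∈ J₀ × (toℕ i < toℕ u × toℕ j ≡ suc (toℕ i) ⊎ toℕ u < toℕ i × suc (toℕ j) ≡ toℕ i)

  Step⇒Adj : {i j : Fin n} → Step i j → Adj i j
  Step⇒Adj (_ , inj₁ (_ , j≡1+i)) = inj₁ (sym j≡1+i)
  Step⇒Adj (_ , inj₂ (_ , 1+j≡i)) = inj₂ 1+j≡i

  Step-functional : {i j j′ : Fin n} → Step i j → Step i j′ → j ≡ j′
  Step-functional (_ , inj₁ (_ , e)) (_ , inj₁ (_ , e′)) = toℕ-injective (trans e (sym e′))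
  Step-functional (_ , inj₂ (_ , e)) (_ , inj₂ (_ , e′)) = toℕ-injective (suc-injective (trans e (sym e′)))
  Step-functional (_ , inj₁ (i<u , _)) (_ , inj₂ (u<i , _)) = ⊥-elim (<-asym i<u u<i)
  Step-functional (_ , inj₂ (u<i , _)) (_ , inj₁ (i<u , _)) = ⊥-elim (<-asym i<u u<i)

  Step-exists : {i : Fin n} → i ∈ J₀ → ∃ (Step i)
  Step-exists {i} i∈J₀ with <-cmp (toℕ i) (toℕ u)
  ... | tri< i<u _ _ = let (j , e) = next-above i<u in j , i∈J₀ , inj₁ (i<u , e)
  ... | tri≈ _ i≡u _ = ⊥-elim (u∉J₀ (subst (_∈ J₀) (toℕ-injective i≡u) i∈J₀))
  ... | tri> _ _ u<i = let (j , e) = next-below u<i in j , i∈J₀ , inj₂ (u<i , e)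

  distance : Fin n → ℕ
  distance i = ∣ toℕ i - toℕ u ∣

  Step-decreasing : {i j : Fin n} → Step i j → distance j < distance i
  Step-decreasing {i} {j} (_ , inj₁ (i<u , j≡1+i)) =
    subst₂ _<_ (sym (m≤n⇒∣m-n∣≡n∸m j≤u)) (sym (m≤n⇒∣m-n∣≡n∸m (<⇒≤ i<u))) (∸-monoʳ-< i<j j≤u)
    where
    j≤u = subst (_≤ toℕ u) (sym j≡1+i) i<u
    i<j = subst (toℕ i <_) (sym j≡1+i) ≤-refl
  Step-decreasing {i} {j} (_ , inj₂ (u<i , 1+j≡i)) =
    subst₂ _<_ (sym (m≤n⇒∣n-m∣≡n∸m u≤j)) (sym (m≤n⇒∣n-m∣≡n∸m (<⇒≤ u<i))) (∸-monoˡ-< j<i u≤j)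
    where
    u≤j = m<1+n⇒m≤n (subst (toℕ u <_) (sym 1+j≡i) u<i)
    j<i = subst (toℕ j <_) 1+j≡i ≤-refl

  Step-wellFounded : WellFounded (flip Step)
  Step-wellFounded = Subrelation.wellFounded Step-decreasing (On.wellFounded distance <-wellFounded)

  Step-rec : (P : Fin n → Set) → (∀ i → (∀ {j} → Step i j → P j) → P i) → ∀ i → P i
  Step-rec P = WF.All.wfRec Step-wellFounded _ P

  StepClosed : Subset n → Set
  StepClosed I = ∀ {i j} → Step i j → i ∈ I → j ∈ I

  admissible⇒closed : {I : Subset n} → Admissible J₀ I → StepClosed I
  admissible⇒closed {I} adm {i} {j} (i∈J₀ , side) i∈ with adm i i∈
  ... | k , path , k∉ with side | <-cmp (toℕ i) (toℕ k)
  ... | _ | tri≈ _ i≡k _ = ⊥-elim (k∉ (subst (_∈ J₀) (toℕ-injective i≡k) i∈J₀))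
  ... | inj₁ (i<u , _) | tri> _ _ k<i = ⊥-elim (between-outside k<i i<u k∉ u∉J₀ i∈J₀)
  ... | inj₂ (u<i , _) | tri< i<k _ _ = ⊥-elim (between-outside u<i i<k u∉J₀ k∉ i∈J₀)
  ... | inj₁ (_ , j≡1+i) | tri< i<k _ _ =
    Conn-between path (subst (toℕ i ≤_) (sym j≡1+i) (n≤1+n _)) (subst (_≤ toℕ k) (sym j≡1+i) i<k)
  ... | inj₂ (_ , 1+j≡i) | tri> _ _ k<i =
    Conn-between (Conn-reverse path) (m<1+n⇒m≤n (subst (toℕ k <_) (sym 1+j≡i) k<i))
                 (subst (toℕ j ≤_) 1+j≡i (n≤1+n _))

  closed⇒admissible : {I : Subset n} → StepClosed I → Admissible J₀ I
  closed⇒admissible {I} closed = Step-rec (λ i → i ∈ I → ∃ λ k → Conn I i k × k ∉ J₀) reach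
    where
    reach : ∀ i → (∀ {j} → Step i j → j ∈ I → ∃ λ k → Conn I j k × k ∉ J₀) →
            i ∈ I → ∃ λ k → Conn I i k × k ∉ J₀
    reach i ih i∈ with i ∈? J₀
    ... | no i∉J₀ = i , here i∈ , i∉J₀
    ... | yes i∈J₀ =
      let (j , s) = Step-exists i∈J₀
          (k , path , k∉J₀) = ih s (closed s i∈)
      in k , Conn-prepend (Step⇒Adj s) i∈ path , k∉J₀

  Sink : Subset n → Subset n → Set
  Sink A B = ∃ λ d → d ∈ B × d ∉ A × (∀ {j} → Step d j → j ∈ A)

  sink : {A B : Subset n} {e : Fin n} → StepClosed B → e ∈ B → e ∉ A → Sink A B
  sink {A} {B} {e} closed = Step-rec (λ e → e ∈ B → e ∉ A → Sink A B) descend e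
    where
    descend : ∀ e → (∀ {j} → Step e j → j ∈ B → j ∉ A → Sink A B) → e ∈ B → e ∉ A → Sink A B
    descend e ih e∈B e∉A with e ∈? J₀
    ... | no e∉J₀ = e , e∈B , e∉A , λ s → ⊥-elim (e∉J₀ (proj₁ s))
    ... | yes e∈J₀ with Step-exists e∈J₀
    ...   | j , s with j ∈? A
    ...     | yes j∈A = e , e∈B , e∉A , λ s′ → subst (_∈ A) (Step-functional s s′) j∈A
    ...     | no j∉A = ih s (closed s e∈B) j∉A

  StepsEarlier : {A B : Subset n} {k : ℕ} → Extension A B k → Set
  StepsEarlier {A} E = ∀ i {j} → Step (root i) j → j ∈ A ⊎ ∃ λ l → toℕ l < toℕ i × j ≡ root l
    where open Extension E

  LayeredExtension : Subset n → Subset n → ℕ → Set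
  LayeredExtension A B k = Σ (Extension A B k) StepsEarlier

  -- The new root is a sink of B ∖ A: adding a sink to A keeps it admissible, so nothing else can be new.
  covers⇒extension : {a b : ΛStar J₀} → Covers a b → LayeredExtension (proj₁ a) (proj₁ b) 1
  covers⇒extension {A , admA} {B , admB} ((A⊆B , B⊈A) , nothing-between) =
    record { root = λ _ → d ; root-injective = λ { {0F} {0F} _ → refl } ; A⊆B = A⊆B
           ; root∉A = λ _ → d∉A ; root∈B = λ _ → d∈B ; B⊆A∪roots = B⊆A∪d }
    , λ { 0F s → inj₁ (d-steps s) }
    where
    e∈B∖A = ⊈⇒∃∉ B⊈A
    sunk = sink (admissible⇒closed admB) (proj₁ (proj₂ e∈B∖A)) (proj₂ (proj₂ e∈B∖A))
    d = proj₁ sunk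
    d∈B = proj₁ (proj₂ sunk)
    d∉A = proj₁ (proj₂ (proj₂ sunk))
    d-steps = proj₂ (proj₂ (proj₂ sunk))
    C = A ∪ ⁅ d ⁆
    ∈C⁻ : ∀ {e} → e ∈ C → e ∈ A ⊎ e ≡ d
    ∈C⁻ e∈C = Sum.map₂ (x∈⁅y⁆⇒x≡y d) (x∈p∪q⁻ A ⁅ d ⁆ e∈C)
    A⊆C : A ⊆ C
    A⊆C = p⊆p∪q ⁅ d ⁆
    C⊆B : C ⊆ B
    C⊆B e∈C = Sum.[ A⊆B , (λ { refl → d∈B }) ] (∈C⁻ e∈C)
    C-closed : StepClosed C
    C-closed s i∈C with ∈C⁻ i∈C
    ... | inj₁ i∈A = A⊆C (admissible⇒closed admA s i∈A)
    ... | inj₂ refl = A⊆C (d-steps s)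
    B⊆A∪d : ∀ {e} → e ∈ B → e ∈ A ⊎ ∃ λ (_ : Fin 1) → e ≡ d
    B⊆A∪d {e} e∈B with e ∈? A | e ≟ d
    ... | yes e∈A | _ = inj₁ e∈A
    ... | no _ | yes e≡d = inj₂ (0F , e≡d)
    ... | no e∉A | no e≢d = ⊥-elim (nothing-between (C , closed⇒admissible C-closed)
      (A⊆C , λ C⊆A → d∉A (C⊆A (q⊆p∪q A ⁅ d ⁆ (x∈⁅x⁆ d))))
      (C⊆B , λ B⊆C → Sum.[ e∉A , e≢d ] (∈C⁻ (B⊆C e∈B))))

  ◅-stepsEarlier : {A B C : Subset n} {k : ℕ} {E : Extension A B 1} {F : Extension B C k} →
                   StepsEarlier E → StepsEarlier F → StepsEarlier (E ◅ F)
  ◅-stepsEarlier E-steps F-steps 0F s with E-steps 0F s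
  ... | inj₁ j∈A = inj₁ j∈A
  ◅-stepsEarlier {E = E} E-steps F-steps (suc i) s with F-steps i s
  ... | inj₂ (l , l<i , j≡r) = inj₂ (suc l , s≤s l<i , j≡r)
  ... | inj₁ j∈B = Sum.map₂ (λ j≡d → 0F , s≤s z≤n , j≡d) (B⊆A∪root₀ E j∈B)

  satChain⇒extension : {a b : ΛStar J₀} {k : ℕ} → SatChain a b k → LayeredExtension (proj₁ a) (proj₁ b) k
  satChain⇒extension ([] a≤b b≤a) = empty-extension a≤b b≤a , λ ()
  satChain⇒extension {a} (_∷_ {b = b} cover chain) =
    let (E , E-steps) = covers⇒extension {a} {b} cover
        (F , F-steps) = satChain⇒extension chain
    in E ◅ F , ◅-stepsEarlier {E = E} {F} E-steps F-steps

  step-profile : {A B : Subset n} {k : ℕ} ((E , _) : LayeredExtension A B k) (i : Fin k) →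
                 let open Extension E in
                 (∀ {j} → Step (root i) j → j ∈ A) ⊎ ∃ λ l → toℕ l < toℕ i × Step (root i) (root l)
  step-profile {A} (E , E-steps) i with root i ∈? J₀
    where open Extension E
  ... | no r∉J₀ = inj₁ (λ s → ⊥-elim (r∉J₀ (proj₁ s)))
  ... | yes r∈J₀ with Step-exists r∈J₀
  ...   | j , s with E-steps i s
  ...     | inj₁ j∈A = inj₁ (λ s′ → subst (_∈ A) (Step-functional s s′) j∈A)
  ...     | inj₂ (l , l<i , refl) = inj₂ (l , l<i , s)

  outside-between : {i i′ w : Fin n} → toℕ i < toℕ u → toℕ u < toℕ i′ → i ∈ J₀ → i′ ∈ J₀ → w ∉ J₀ →
                    toℕ i < toℕ w × toℕ w < toℕ i′
  outside-between {i} {i′} {w} i<u u<i′ i∈ i′∈ w∉ = above , below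
    where
    above : toℕ i < toℕ w
    above with <-cmp (toℕ w) (toℕ i)
    ... | tri< w<i _ _ = ⊥-elim (between-outside w<i i<u w∉ u∉J₀ i∈)
    ... | tri≈ _ w≡i _ = ⊥-elim (w∉ (subst (_∈ J₀) (toℕ-injective (sym w≡i)) i∈))
    ... | tri> _ _ i<w = i<w
    below : toℕ w < toℕ i′
    below with <-cmp (toℕ w) (toℕ i′)
    ... | tri< w<i′ _ _ = w<i′
    ... | tri≈ _ w≡i′ _ = ⊥-elim (w∉ (subst (_∈ J₀) (toℕ-injective (sym w≡i′)) i′∈))
    ... | tri> _ _ i′<w = ⊥-elim (between-outside u<i′ i′<w u∉J₀ w∉ i′∈)

  module _ {v : Fin n} (v∉J₀ : v ∉ J₀) (u≢v : u ≢ v) where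

    -- A common step j of J₀-roots on either side of u would be the only root between them: u = j = v.
    no-common-step-across : {i i′ j : Fin n} → i ∈ J₀ → i′ ∈ J₀ → toℕ i < toℕ u → toℕ u < toℕ i′ →
                            toℕ j ≡ suc (toℕ i) → suc (toℕ j) ≡ toℕ i′ → ⊥
    no-common-step-across i∈ i′∈ i<u u<i′ j≡1+i 1+j≡i′ = u≢v (trans (in-gap u∉J₀) (sym (in-gap v∉J₀)))
      where
      in-gap : ∀ {w} → w ∉ J₀ → w ≡ _
      in-gap w∉ = let (i<w , w<i′) = outside-between i<u u<i′ i∈ i′∈ w∉ in
        toℕ-injective (≤-antisym (m<1+n⇒m≤n (subst (_ <_) (sym 1+j≡i′) w<i′)) (subst (_≤ _) (sym j≡1+i) i<w))

    Step-injective : {i i′ j : Fin n} → Step i j → Step i′ j → i ≡ i′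
    Step-injective (_ , inj₁ (_ , e)) (_ , inj₁ (_ , e′)) = toℕ-injective (suc-injective (trans (sym e) e′))
    Step-injective (_ , inj₂ (_ , e)) (_ , inj₂ (_ , e′)) = toℕ-injective (trans (sym e) e′)
    Step-injective (i∈ , inj₁ (i<u , e)) (i′∈ , inj₂ (u<i′ , e′)) =
      ⊥-elim (no-common-step-across i∈ i′∈ i<u u<i′ e e′)
    Step-injective (i∈ , inj₂ (u<i , e)) (i′∈ , inj₁ (i′<u , e′)) =
      ⊥-elim (no-common-step-across i′∈ i∈ i′<u u<i e′ e)

  StepTarget : {A B : Subset n} {k : ℕ} → Extension A B k → Fin k → Maybe (Fin k) → Set
  StepTarget {A} E i nothing = ∀ {j} → Step (Extension.root E i) j → j ∈ A
  StepTarget E i (just l) = Step (Extension.root E i) (Extension.root E l)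

  module _ {A B : Subset n} {k : ℕ} (E : Extension A B k) {t : Fin k → Maybe (Fin k)}
           (targets : ∀ i → StepTarget E i (t i)) where
    open Extension E

    preimage-targetClosed : ∀ {Z} → StepClosed Z → TargetClosed t (preimage E Z)
    preimage-targetClosed closed {i} i∈ with t i | targets i
    ... | nothing | _ = nothing
    ... | just l | s = just (∈-preimage⁺ E (closed s (∈-preimage⁻ E i∈)))

    extend-closed : ∀ {S} → StepClosed A → TargetClosed t S → StepClosed (extend E S)
    extend-closed A-closed S-closed s e∈ with ∈-extend⁻ E e∈
    ... | inj₁ e∈A = A⊆extend E (A-closed s e∈A)
    ... | inj₂ (i , i∈S , refl) with t i | targets i | S-closed i∈S
    ...   | nothing | to-A | _ = A⊆extend E (to-A s)
    ...   | just l | s′ | just l∈S = subst (_∈ extend E _) (Step-functional s′ s) (root∈extend E l∈S)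

  interval-iso : {P : FinPoset} (x y : ΛStar J₀) {k : ℕ} (E : Extension (proj₁ x) (proj₁ y) k)
                 {t : Fin k → Maybe (Fin k)} → (∀ i → StepTarget E i (t i)) →
                 SubsetModel P (TargetClosed t) → IntervalIso x y P
  interval-iso (X , admX) (Y , admY) E {t} targets model = record
    { to      = λ ((Z , _) , _) → decode (preimage E Z)
    ; from    = λ p → (extend E (code p) , closed⇒admissible (extend-closed E targets X-closed (code-valid p))) ,
                      A⊆extend E , extend⊆B E
    ; from∘to = λ ((Z , admZ) , X⊆Z , Z⊆Y) →
        trans (cong (extend E) (code-decode (valid admZ))) (extend-preimage E X⊆Z Z⊆Y)
    ; to∘from = λ p → trans (cong decode (preimage-extend E)) (decode-code p)
    ; mono    = λ ((Z , admZ) , _) ((W , admW) , _) Z⊆W →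
        code-reflect (subst₂ _⊆_ (sym (code-decode (valid admZ))) (sym (code-decode (valid admW)))
                             (preimage-mono E Z⊆W))
    ; reflect = λ ((Z , admZ) , _ , Z⊆Y) ((W , admW) , X⊆W , _) to-z⊑to-w →
        preimage-reflect E X⊆W Z⊆Y (subst₂ _⊆_ (code-decode (valid admZ)) (code-decode (valid admW))
                                            (code-mono to-z⊑to-w))
    }
    where
    open SubsetModel model
    X-closed = admissible⇒closed admX
    valid : ∀ {Z} → Admissible J₀ Z → TargetClosed t (preimage E Z)
    valid admZ = preimage-targetClosed E targets (admissible⇒closed admZ)

decide-⊆ : (p q : Subset n) → {True (p ⊆? q)} → p ⊆ q
decide-⊆ p q {p⊆q} = toWitness p⊆q

boolean-model : SubsetModel Boolean3 (TargetClosed {3} (λ _ → nothing))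
boolean-model = record
  { code = λ S → S ; decode = λ S → S ; code-valid = λ _ _ → nothing
  ; decode-code = λ _ → refl ; code-decode = λ _ → refl
  ; code-mono = λ p⊆q → p⊆q ; code-reflect = λ p⊆q → p⊆q }

pair-target : Fin 3 → Maybe (Fin 3)
pair-target 1F = just 0F
pair-target _ = nothing

-- Poset6 is the lattice of down-sets of the poset {0 < 1} ⊎ {2}, with a, b, c, d, e, f (= 0F … 5F)
-- being ∅, {2}, {0}, {0,2}, {0,1}, {0,1,2}.
grid : Fin 6 → Subset 3
grid 0F = outside ∷ outside ∷ outside ∷ []
grid 1F = outside ∷ outside ∷ inside ∷ []
grid 2F = inside ∷ outside ∷ outside ∷ []
grid 3F = inside ∷ outside ∷ inside ∷ []
grid 4F = inside ∷ inside ∷ outside ∷ []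
grid 5F = inside ∷ inside ∷ inside ∷ []

grid⁻¹ : Subset 3 → Fin 6
grid⁻¹ (outside ∷ outside ∷ outside ∷ []) = 0F
grid⁻¹ (outside ∷ outside ∷ inside ∷ []) = 1F
grid⁻¹ (inside ∷ outside ∷ outside ∷ []) = 2F
grid⁻¹ (inside ∷ outside ∷ inside ∷ []) = 3F
grid⁻¹ (inside ∷ inside ∷ outside ∷ []) = 4F
grid⁻¹ (inside ∷ inside ∷ inside ∷ []) = 5F
grid⁻¹ (outside ∷ inside ∷ _ ∷ []) = 0F

grid-valid : ∀ p → TargetClosed pair-target (grid p)
grid-valid p {0F} _ = nothing
grid-valid p {2F} _ = nothing
grid-valid 4F {1F} _ = just here
grid-valid 5F {1F} _ = just here
grid-valid 0F {1F} (there ())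
grid-valid 1F {1F} (there ())
grid-valid 2F {1F} (there ())
grid-valid 3F {1F} (there ())

grid-decode : ∀ {S} → TargetClosed pair-target S → grid (grid⁻¹ S) ≡ S
grid-decode {outside ∷ outside ∷ outside ∷ []} _ = refl
grid-decode {outside ∷ outside ∷ inside ∷ []} _ = refl
grid-decode {inside ∷ outside ∷ outside ∷ []} _ = refl
grid-decode {inside ∷ outside ∷ inside ∷ []} _ = refl
grid-decode {inside ∷ inside ∷ outside ∷ []} _ = refl
grid-decode {inside ∷ inside ∷ inside ∷ []} _ = refl
grid-decode {outside ∷ inside ∷ _ ∷ []} closed with closed (there here)
... | just ()

grid-mono : ∀ {p q} → Le6 p q → grid p ⊆ grid q
grid-mono refl6 = λ x∈ → x∈
grid-mono a<b = decide-⊆ _ _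
grid-mono a<c = decide-⊆ _ _
grid-mono b<d = decide-⊆ _ _
grid-mono c<d = decide-⊆ _ _
grid-mono c<e = decide-⊆ _ _
grid-mono e<f = decide-⊆ _ _
grid-mono d<f = decide-⊆ _ _
grid-mono (trans6 p≤q q≤r) = grid-mono q≤r ∘ grid-mono p≤q

grid-reflect : ∀ p q → True (grid p ⊆? grid q) → Le6 p q
grid-reflect 0F 0F _ = refl6
grid-reflect 0F 1F _ = a<b
grid-reflect 0F 2F _ = a<c
grid-reflect 0F 3F _ = trans6 a<b b<d
grid-reflect 0F 4F _ = trans6 a<c c<e
grid-reflect 0F 5F _ = trans6 (trans6 a<b b<d) d<f
grid-reflect 1F 0F ()
grid-reflect 1F 1F _ = refl6
grid-reflect 1F 2F ()
grid-reflect 1F 3F _ = b<d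
grid-reflect 1F 4F ()
grid-reflect 1F 5F _ = trans6 b<d d<f
grid-reflect 2F 0F ()
grid-reflect 2F 1F ()
grid-reflect 2F 2F _ = refl6
grid-reflect 2F 3F _ = c<d
grid-reflect 2F 4F _ = c<e
grid-reflect 2F 5F _ = trans6 c<d d<f
grid-reflect 3F 0F ()
grid-reflect 3F 1F ()
grid-reflect 3F 2F ()
grid-reflect 3F 3F _ = refl6
grid-reflect 3F 4F ()
grid-reflect 3F 5F _ = d<f
grid-reflect 4F 0F ()
grid-reflect 4F 1F ()
grid-reflect 4F 2F ()
grid-reflect 4F 3F ()
grid-reflect 4F 4F _ = refl6
grid-reflect 4F 5F _ = e<f
grid-reflect 5F 0F ()
grid-reflect 5F 1F ()
grid-reflect 5F 2F ()
grid-reflect 5F 3F ()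
grid-reflect 5F 4F ()
grid-reflect 5F 5F _ = refl6

grid-model : SubsetModel Poset6 (TargetClosed pair-target)
grid-model = record
  { code = grid ; decode = grid⁻¹ ; code-valid = grid-valid
  ; decode-code = λ { 0F → refl ; 1F → refl ; 2F → refl ; 3F → refl ; 4F → refl ; 5F → refl }
  ; code-decode = grid-decode ; code-mono = grid-mono
  ; code-reflect = λ {p} {q} p⊆q → grid-reflect p q (fromWitness (λ {x} → p⊆q {x})) }

chain-target : Fin 3 → Maybe (Fin 3)
chain-target 0F = nothing
chain-target 1F = just 0F
chain-target 2F = just 1F

below? : (p : Fin 4) (i : Fin 3) → Dec (toℕ i < toℕ p)
below? p i = toℕ i <? toℕ p

initial : Fin 4 → Subset 3
initial p = subset (below? p)

∣initial∣ : ∀ p → ∣ initial p ∣ ≡ toℕ p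
∣initial∣ 0F = refl
∣initial∣ 1F = refl
∣initial∣ 2F = refl
∣initial∣ 3F = refl

initial-valid : ∀ p → TargetClosed chain-target (initial p)
initial-valid p {0F} _ = nothing
initial-valid p {1F} 1∈ = just (∈-subset⁺ (below? p) (<⇒≤ (∈-subset⁻ (below? p) 1∈)))
initial-valid p {2F} 2∈ = just (∈-subset⁺ (below? p) (<⇒≤ (∈-subset⁻ (below? p) 2∈)))

-- correct only on initial segments
size : Subset 3 → Fin 4
size S = fromℕ< (s≤s (∣p∣≤n S))

initial-size : ∀ {S} → TargetClosed chain-target S → initial (size S) ≡ S
initial-size {outside ∷ outside ∷ outside ∷ []} _ = refl
initial-size {inside ∷ outside ∷ outside ∷ []} _ = refl
initial-size {inside ∷ inside ∷ outside ∷ []} _ = refl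
initial-size {inside ∷ inside ∷ inside ∷ []} _ = refl
initial-size {outside ∷ inside ∷ _ ∷ []} closed with closed (there here)
... | just ()
initial-size {_ ∷ outside ∷ inside ∷ []} closed with closed (there (there here))
... | just (there ())

chain-model : SubsetModel Chain4 (TargetClosed chain-target)
chain-model = record
  { code = initial ; decode = size ; code-valid = initial-valid
  ; decode-code = λ { 0F → refl ; 1F → refl ; 2F → refl ; 3F → refl }
  ; code-decode = initial-size
  ; code-mono = λ {p} {q} p≤q i∈ → ∈-subset⁺ (below? q) (<-≤-trans (∈-subset⁻ (below? p) i∈) p≤q)
  ; code-reflect = λ {p} {q} p⊆q → subst₂ _≤_ (∣initial∣ p) (∣initial∣ q) (p⊆q⇒∣p∣≤∣q∣ p⊆q) }

data Shape : Set where
  antichain pair chain : Shape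

target : Shape → Fin 3 → Maybe (Fin 3)
target antichain = λ _ → nothing
target pair = pair-target
target chain = chain-target

poset : Shape → FinPoset
poset antichain = Boolean3
poset pair = Poset6
poset chain = Chain4

model : (s : Shape) → SubsetModel (poset s) (TargetClosed (target s))
model antichain = boolean-model
model pair = grid-model
model chain = chain-model

by-shape : {J₀ : Subset n} {x y : ΛStar J₀} (s : Shape) → IntervalIso x y (poset s) →
           IntervalIso x y Boolean3 ⊎ IntervalIso x y Poset6 ⊎ IntervalIso x y Chain4
by-shape antichain = inj₁
by-shape pair = inj₂ ∘ inj₁
by-shape chain = inj₂ ∘ inj₂

module Rank3 {n : ℕ} (J₀ : Subset n) (convex : Convex (∁ J₀)) {u v : Fin n}
             (u∉J₀ : u ∉ J₀) (v∉J₀ : v ∉ J₀) (u≢v : u ≢ v) where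
  open Steps J₀ convex u u∉J₀ public

  -- Root i steps into A or onto an earlier root, and no two roots step onto the same one.
  shape-of : {A B : Subset n} → LayeredExtension A B 3 →
             ∃ λ s → Σ (Extension A B 3) λ E → ∀ i → StepTarget E i (target s i)
  shape-of layered@(E , _)
    with step-profile layered 0F | step-profile layered 1F | step-profile layered 2F
  ... | inj₂ (_ , () , _) | _ | _
  ... | _ | inj₂ (1F , s≤s () , _) | _
  ... | _ | inj₂ (2F , s≤s () , _) | _
  ... | _ | _ | inj₂ (2F , s≤s (s≤s ()) , _)
  ... | inj₁ to-A₀ | inj₁ to-A₁ | inj₁ to-A₂ =
    antichain , E , λ { 0F → to-A₀ ; 1F → to-A₁ ; 2F → to-A₂ }
  ... | inj₁ to-A₀ | inj₂ (0F , _ , s₁₀) | inj₁ to-A₂ =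
    pair , E , λ { 0F → to-A₀ ; 1F → s₁₀ ; 2F → to-A₂ }
  ... | inj₁ to-A₀ | inj₁ to-A₁ | inj₂ (0F , _ , s₂₀) =
    pair , reindex E (transpose 1F 2F) , λ { 0F → to-A₀ ; 1F → s₂₀ ; 2F → to-A₁ }
  ... | inj₁ to-A₀ | inj₁ to-A₁ | inj₂ (1F , _ , s₂₁) =
    pair , reindex E (transpose 1F 2F ∘ₚ transpose 0F 1F) , λ { 0F → to-A₁ ; 1F → s₂₁ ; 2F → to-A₀ }
  ... | inj₁ _ | inj₂ (0F , _ , s₁₀) | inj₂ (0F , _ , s₂₀) =
    ⊥-elim (case Extension.root-injective E (Step-injective v∉J₀ u≢v s₁₀ s₂₀) of λ ())
  ... | inj₁ to-A₀ | inj₂ (0F , _ , s₁₀) | inj₂ (1F , _ , s₂₁) =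
    chain , E , λ { 0F → to-A₀ ; 1F → s₁₀ ; 2F → s₂₁ }

mainTheorem9 : (n : ℕ) → (J₀ : Subset n) →
    Distributive J₀ → 1 < ∣ ∁ J₀ ∣ →
    ∀ (x y : ΛStar J₀) → RankInterval x y 3 →
    IntervalIso x y Boolean3 ⊎ IntervalIso x y Poset6 ⊎ IntervalIso x y Chain4
mainTheorem9 n J₀ distributive 1<∣∁J₀∣ x y (_ , saturated , _) =
  let (u , v , u≢v , u∈∁J₀ , v∈∁J₀) = two-members 1<∣∁J₀∣
      open Rank3 J₀ (distributive⇒convex distributive) (x∈∁p⇒x∉p u∈∁J₀) (x∈∁p⇒x∉p v∈∁J₀) u≢v
      (s , E , targets) = shape-of (satChain⇒extension saturated)
  in by-shape s (interval-iso x y E targets (model s))
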